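{- Let $\tilde p<0$ be an integer and $\tilde q$ a positive integer with $\tilde q\geqslant 97|\tilde p|$. Put $A=\tilde q^{2}+5\tilde p\tilde q+10\tilde p^{2}$, let $p=\tilde p+\tilde q$ and $q=\tilde q$. Then there is no integer $t$ with $A<t<A+\dfrac{74|\tilde p|^3}{\tilde q}$ producing a perfect cuboid, i.e. no such integer $t$ satisfies all of the inequalities $$t>p^2,\qquad t>pq,\qquad t>q^2,\qquad (p^2+t)(pq+t)>2t^2.$$
   Context: A perfect cuboid is a rectangular parallelepiped whose edges, face diagonals and space diagonal all have integer lengths. By a previously established criterion, a triple of positive integers $p,q,t$ with $p\neq q$ coprime satisfying $Q_{pq}(t)=0$, where $Q_{pq}(t)=t^{10}+(2q^2+p^2)(3q^2-2p^2)t^8+(q^8+10p^2q^6+4p^4q^4-14p^6q^2+p^8)t^6-p^2q^2(q^8-14p^2q^6+4p^4q^4+10p^6q^2+p^8)t^4-p^6q^6(q^2+2p^2)(3p^2-2q^2)t^2-q^{10}p^{10}$, produces a perfect cuboid if and only if $t>p^2$, $t>pq$, $t>q^2$ and $(p^2+t)(pq+t)>2t^2$. -}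

module Defs where

open import Data.Integer using (ℤ; _+_; _*_; _<_; _^_; +_)
open import Data.Product using (_×_)

CuboidIneqs : ℤ → ℤ → ℤ → Set
CuboidIneqs p q t =
  (p ^ 2 < t) × (p * q < t) × (q ^ 2 < t) × (+ 2 * t ^ 2 < (p ^ 2 + t) * (p * q + t))

Aval : ℤ → ℤ → ℤ
Aval p̃ q̃ = q̃ ^ 2 + + 5 * p̃ * q̃ + + 10 * p̃ ^ 2

module Submission where

-- Write p̃ = -a with a = |p̃| > 0 and q = q̃, so that
--   A = q² - 5aq + 10a².
-- The whole interval A < t < A + 74a³/q lies below q²: indeed, with k = q - 5a,
--   q³ - (A·q + 74a³) = a·(5q² - 10aq - 74a²) = a·(a² + 40ak + 5k²),
-- which is nonnegative as soon as q ≥ 5a (the hypothesis q ≥ 97a is more than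
-- enough).  Hence t·q < A·q + 74a³ ≤ q³, whereas the cuboid inequality t > q²
-- gives q³ < t·q; so no t in the interval satisfies the criterion, and only the
-- inequality t > q² of the four is needed.

open import Defs
open import Data.Integer using (ℤ; _+_; _-_; _*_; _<_; _≤_; _^_; +_; -_; ∣_∣; 0ℤ; -[1+_]; +≤+; +<+; positive; nonNegative)
open import Data.Integer.Properties
  using (pos-*; +-mono-≤; i≤i+j; ≤-trans; i≤j⇒0≤j-i; *-monoʳ-<-pos; <-irrefl; module ≤-Reasoning)
open import Data.Integer.Tactic.RingSolver using (solve-∀)
import Data.Nat as ℕ
import Data.Nat.Properties as ℕP
open import Data.Product using (_,_)
open import Relation.Nullary using (¬_)
open import Relation.Binary.PropositionalEquality using (_≡_; refl; sym; cong; subst)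

-- The embedding ℕ → ℤ commutes with powers; needed to read the bound 74|p̃|³,
-- which the statement phrases in ℕ, as an integer polynomial.
pos-^ : (a n : ℕ.ℕ) → + (a ℕ.^ n) ≡ (+ a) ^ n
pos-^ a ℕ.zero    = refl
pos-^ a (ℕ.suc n) = subst (λ z → + (a ℕ.* a ℕ.^ n) ≡ + a * z) (pos-^ a n) (pos-* a (a ℕ.^ n))

0≤* : {i j : ℤ} → 0ℤ ≤ i → 0ℤ ≤ j → 0ℤ ≤ i * j
0≤* {+ m} {+ n} _ _ = subst (0ℤ ≤_) (pos-* m n) (+≤+ ℕ.z≤n)

cube-gap : (a q : ℤ) →
  q ^ 2 * q ≡ Aval (- a) q * q + + 74 * a ^ 3
            + a * (a * a + + 40 * a * (q - + 5 * a) + + 5 * (q - + 5 * a) * (q - + 5 * a))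
cube-gap = unfolded
  where
  -- the same identity with Aval and the powers unfolded, which the ring solver
  -- does not look through
  unfolded : (a q : ℤ) →
    q * (q * + 1) * q
      ≡ (q * (q * + 1) + + 5 * (- a) * q + + 10 * ((- a) * ((- a) * + 1))) * q
        + + 74 * (a * (a * (a * + 1)))
        + a * (a * a + + 40 * a * (q + - (+ 5 * a)) + + 5 * (q + - (+ 5 * a)) * (q + - (+ 5 * a)))
  unfolded = solve-∀

gap-nonneg : (a k : ℤ) → 0ℤ ≤ a → 0ℤ ≤ k →
  0ℤ ≤ a * (a * a + + 40 * a * k + + 5 * k * k)
gap-nonneg a k 0≤a 0≤k =
  0≤* 0≤a (+-mono-≤ (+-mono-≤ (0≤* 0≤a 0≤a) (0≤* (0≤* 0≤40 0≤a) 0≤k)) (0≤* (0≤* 0≤5 0≤k) 0≤k))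
  where
  0≤40 : 0ℤ ≤ + 40
  0≤40 = +≤+ ℕ.z≤n
  0≤5 : 0ℤ ≤ + 5
  0≤5 = +≤+ ℕ.z≤n

-- For 0 ≤ a and 5a ≤ q the upper end A + 74a³/q of the interval is at most q²
-- (denominators cleared).
interval-below-square : (a q : ℤ) → 0ℤ ≤ a → + 5 * a ≤ q →
  Aval (- a) q * q + + 74 * a ^ 3 ≤ q ^ 2 * q
interval-below-square a q 0≤a 5a≤q = begin
  Aval (- a) q * q + + 74 * a ^ 3
    ≤⟨ i≤i+j _ gap {{nonNegative (gap-nonneg a (q - + 5 * a) 0≤a (i≤j⇒0≤j-i 5a≤q))}} ⟩
  Aval (- a) q * q + + 74 * a ^ 3 + gap
    ≡⟨ sym (cube-gap a q) ⟩
  q ^ 2 * q ∎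
  where
  gap : ℤ
  gap = a * (a * a + + 40 * a * (q - + 5 * a) + + 5 * (q - + 5 * a) * (q - + 5 * a))
  open ≤-Reasoning

theorem8p1 : (p̃ q̃ : ℤ) → p̃ < 0ℤ → 0ℤ < q̃ → + (97 ℕ.* ∣ p̃ ∣) ≤ q̃ →
    (t : ℤ) → Aval p̃ q̃ < t → t * q̃ < Aval p̃ q̃ * q̃ + + (74 ℕ.* ∣ p̃ ∣ ℕ.^ 3) →
    ¬ CuboidIneqs (p̃ + q̃) q̃ t
theorem8p1 (+ _) _ (+<+ ()) _ _ _ _ _
theorem8p1 -[1+ n ] q _ 0<q 97a≤q t _ tq<bound (_ , _ , q²<t , _) = <-irrefl refl (begin-strict
  t * q                                           <⟨ tq<bound ⟩
  Aval (- a) q * q + + (74 ℕ.* ℕ.suc n ℕ.^ 3)     ≡⟨ cong (_+_ (Aval (- a) q * q)) cube-cast ⟩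
  Aval (- a) q * q + + 74 * a ^ 3                 ≤⟨ interval-below-square a q (+≤+ ℕ.z≤n) 5a≤q ⟩
  q ^ 2 * q                                       <⟨ *-monoʳ-<-pos q {{positive 0<q}} q²<t ⟩
  t * q                                           ∎)
  where
  open ≤-Reasoning
  a : ℤ
  a = + ℕ.suc n
  cube-cast : + (74 ℕ.* ℕ.suc n ℕ.^ 3) ≡ + 74 * a ^ 3
  cube-cast = subst (λ z → + (74 ℕ.* ℕ.suc n ℕ.^ 3) ≡ + 74 * z) (pos-^ (ℕ.suc n) 3) (pos-* 74 (ℕ.suc n ℕ.^ 3))
  5a≤q : + 5 * a ≤ q
  5a≤q = subst (_≤ q) (pos-* 5 (ℕ.suc n)) (≤-trans (+≤+ (ℕP.*-monoˡ-≤ (ℕ.suc n) 5≤97)) 97a≤q)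
    where
    5≤97 : 5 ℕ.≤ 97
    5≤97 = ℕP.m≤m+n 5 92
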